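{- Let $r\ge 3$. For every $r$-uniform loose path $\mathcal{P}$ of length $\ell>2$, $\chi^{e}(\mathcal{P})=1$. Also, if $\mathcal{P}$ is the $r$-uniform tight path of length $\ell>2$, then $\chi^{e}(\mathcal{P})=2$ when $\ell\ge 2r-1$ and $\chi^{e}(\mathcal{P})=1$ otherwise.
   Context: The $r$-uniform $t$-tight path $\mathcal{P}_{n,t}^{(r)}$ ($1\le t<r$) has vertex set $\{1,\dots,n\}$ and edges $e_1,\dots,e_\ell$ with $\ell=\frac{n-t}{r-t}$ an integer and $e_i=\{(i-1)(r-t)+1,\dots,(i-1)(r-t)+r\}$; its length is $\ell$. A loose path is the case $t=1$, a tight path the case $t=r-1$. For $w:E\to\{1,\dots,k\}$, $\sigma^{e}(v)=\sum_{e\ni v}w(e)$; a vertex coloring is proper if every edge contains two vertices of distinct colors; $\chi^{e}(\mathcal{H})$ is the least $k$ such that some $w$ makes $\sigma^{e}$ proper. -}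

module Defs where

open import Data.Nat using (ℕ; zero; suc; _+_; _*_; _∸_; _≤_; _<_; _≤?_; _<?_)
open import Data.Fin using (Fin; toℕ)
import Data.Fin as F
open import Data.Bool using (Bool; true; false; _∧_; if_then_else_)
open import Data.Product using (Σ; _×_; ∃-syntax)
open import Relation.Nullary using (¬_; does)
open import Relation.Binary.PropositionalEquality using (_≡_; _≢_)

sumFin : ∀ {n} → (Fin n → ℕ) → ℕ
sumFin {zero}  f = 0
sumFin {suc n} f = f F.zero + sumFin (λ i → f (F.suc i))

-- The r-uniform t-tight path of length ℓ, with vertices relabelled
-- 0,…,n-1 (n = t + ℓ(r-t)) and edges indexed by i : Fin ℓ (0-based):
-- e_i = { i(r-t), …, i(r-t)+r-1 }.
-- (This is the paper's path shifted by 1 on vertices and edge indices.)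
InEdge : (r t ℓ : ℕ) → ℕ → Fin ℓ → Set
InEdge r t ℓ v i = (toℕ i * (r ∸ t) ≤ v) × (v < toℕ i * (r ∸ t) + r)

inEdge? : (r t ℓ : ℕ) → ℕ → Fin ℓ → Bool
inEdge? r t ℓ v i = does (toℕ i * (r ∸ t) ≤? v) ∧ does (v <? toℕ i * (r ∸ t) + r)

σ : (r t ℓ : ℕ) → (Fin ℓ → ℕ) → ℕ → ℕ
σ r t ℓ w v = sumFin (λ i → if inEdge? r t ℓ v i then w i else 0)

IsWeighting : (ℓ k : ℕ) → (Fin ℓ → ℕ) → Set
IsWeighting ℓ k w = ∀ i → (1 ≤ w i) × (w i ≤ k)

ProperSigma : (r t ℓ : ℕ) → (Fin ℓ → ℕ) → Set
ProperSigma r t ℓ w =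
  ∀ (i : Fin ℓ) → ∃[ u ] ∃[ v ]
    (InEdge r t ℓ u i × InEdge r t ℓ v i × σ r t ℓ w u ≢ σ r t ℓ w v)

EdgeColourable : (r t ℓ k : ℕ) → Set
EdgeColourable r t ℓ k = ∃[ w ] (IsWeighting ℓ k w × ProperSigma r t ℓ w)

ChiE≡ : (r t ℓ k : ℕ) → Set
ChiE≡ r t ℓ k = EdgeColourable r t ℓ k × (∀ k′ → k′ < k → ¬ EdgeColourable r t ℓ k′)

-- Read the edges of a t-tight path as the windows [j(r-t), j(r-t)+r) and σ(v) as the total
-- weight of the windows covering v.  For the loose path with unit weights every edge has an
-- inner vertex (σ = 1) and a vertex shared with a neighbouring edge (σ = 2).  For the tight
-- path, passing from v to v+1 adds the window starting at v+1 and drops the window ending at v,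
-- so σ(v+1) - σ(v) = w(e_{v+1}) - w(e_{v+1-r}).  With unit weights this difference vanishes
-- throughout the edge e_{r-1} as soon as ℓ ≥ 2r-1, while for ℓ ≤ 2r-2 every edge contains a
-- step where exactly one of the two windows exists.  Weighting the edges by blocks of r,
-- alternately 2 and 1, gives w(e_j) ≠ w(e_{j-r}) and hence a proper σ whenever r ≤ ℓ.
module Submission where

open import Defs
open import Data.Bool using (if_then_else_)
open import Data.Empty using (⊥-elim)
open import Data.Fin using (Fin; toℕ; fromℕ<)
import Data.Fin as F
open import Data.Fin.Properties using (toℕ<n; toℕ-fromℕ<)
open import Data.Nat
open import Data.Nat.DivMod using (_/_; m/n≡1+[m∸n]/n)
open import Data.Nat.Properties
open import Algebra.Properties.CommutativeSemigroup +-commutativeSemigroup using (interchange)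
open import Data.Parity.Base using (Parity; 0ℙ; 1ℙ)
open import Data.Parity.Properties using (suc-homo-⁻¹; p≢p⁻¹)
open import Data.Product using (_×_; _,_; proj₁; proj₂; ∃-syntax)
open import Data.Sum using (_⊎_; inj₁; inj₂; [_,_])
open import Function using (_∘_; id)
open import Relation.Binary.PropositionalEquality hiding ([_])
open import Relation.Binary.Definitions using (tri<; tri≈; tri>)
open import Relation.Nullary using (Dec; does; ¬_; yes; no; _×-dec_)
open import Relation.Nullary.Decidable using (dec-true; dec-false)

sumBelow : ℕ → (ℕ → ℕ) → ℕ
sumBelow zero    h = 0
sumBelow (suc n) h = h 0 + sumBelow n (h ∘ suc)

sumFin-toℕ : ∀ n (h : ℕ → ℕ) → sumFin {n} (h ∘ toℕ) ≡ sumBelow n h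
sumFin-toℕ zero    h = refl
sumFin-toℕ (suc n) h = cong (h 0 +_) (sumFin-toℕ n (h ∘ suc))

sumFin-cong : ∀ n {f g : Fin n → ℕ} → (∀ i → f i ≡ g i) → sumFin f ≡ sumFin g
sumFin-cong zero    f≗g = refl
sumFin-cong (suc n) f≗g = cong₂ _+_ (f≗g F.zero) (sumFin-cong n (f≗g ∘ F.suc))

sumBelow-cong : ∀ n {f g : ℕ → ℕ} → (∀ j → j < n → f j ≡ g j) → sumBelow n f ≡ sumBelow n g
sumBelow-cong zero    f≗g = refl
sumBelow-cong (suc n) f≗g =
  cong₂ _+_ (f≗g 0 z<s) (sumBelow-cong n (λ j j<n → f≗g (suc j) (s<s j<n)))

sumBelow-+ : ∀ n (f g : ℕ → ℕ) → sumBelow n (λ j → f j + g j) ≡ sumBelow n f + sumBelow n g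
sumBelow-+ zero    f g = refl
sumBelow-+ (suc n) f g =
  trans (cong (f 0 + g 0 +_) (sumBelow-+ n (f ∘ suc) (g ∘ suc))) (interchange (f 0) (g 0) _ _)

sumBelow-zero : ∀ n {h} → (∀ j → j < n → h j ≡ 0) → sumBelow n h ≡ 0
sumBelow-zero zero    h≡0 = refl
sumBelow-zero (suc n) h≡0 =
  cong₂ _+_ (h≡0 0 z<s) (sumBelow-zero n (λ j j<n → h≡0 (suc j) (s<s j<n)))

sumBelow-single : ∀ n {h a} → a < n → (∀ j → j < n → j ≢ a → h j ≡ 0) → sumBelow n h ≡ h a
sumBelow-single (suc n) {h} {zero} _ h≡0 =
  trans (cong (h 0 +_) (sumBelow-zero n (λ j j<n → h≡0 (suc j) (s<s j<n) λ ())))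
        (+-identityʳ (h 0))
sumBelow-single (suc n) {h} {suc a} (s<s a<n) h≡0 =
  trans (cong (_+ sumBelow n (h ∘ suc)) (h≡0 0 z<s λ ()))
        (sumBelow-single n a<n (λ j j<n j≢a → h≡0 (suc j) (s<s j<n) (j≢a ∘ suc-injective)))

term≤sumBelow : ∀ n h {a} → a < n → h a ≤ sumBelow n h
term≤sumBelow (suc n) h {zero}  _         = m≤m+n (h 0) _
term≤sumBelow (suc n) h {suc a} (s<s a<n) =
  ≤-trans (term≤sumBelow n (h ∘ suc) a<n) (m≤n+m _ (h 0))

twoTerms≤sumBelow : ∀ n h {a b} → a < b → b < n → h a + h b ≤ sumBelow n h
twoTerms≤sumBelow (suc n) h {zero}  {suc b} _         (s<s b<n) =
  +-monoʳ-≤ (h 0) (term≤sumBelow n (h ∘ suc) b<n)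
twoTerms≤sumBelow (suc n) h {suc a} {suc b} (s<s a<b) (s<s b<n) =
  ≤-trans (twoTerms≤sumBelow n (h ∘ suc) a<b b<n) (m≤n+m _ (h 0))

infix 7 _if?_

_if?_ : {P : Set} → ℕ → Dec P → ℕ
x if? P? = if does P? then x else 0

if?-yes : ∀ {P : Set} x (P? : Dec P) → P → x if? P? ≡ x
if?-yes x P? p rewrite dec-true P? p = refl

if?-no : ∀ {P : Set} x (P? : Dec P) → ¬ P → x if? P? ≡ 0
if?-no x P? ¬p rewrite dec-false P? ¬p = refl

if?-disjoint-⊎ : ∀ {P Q S : Set} x (P? : Dec P) (Q? : Dec Q) (S? : Dec S) →
  (S → P ⊎ Q) → (P → S) → (Q → S) → ¬ (P × Q) → x if? P? + x if? Q? ≡ x if? S?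
if?-disjoint-⊎ x (yes p) (yes q) S? _  _   _   disjoint = ⊥-elim (disjoint (p , q))
if?-disjoint-⊎ x (yes p) (no _)  S? _  P⇒S _   _        =
  trans (+-identityʳ x) (sym (if?-yes x S? (P⇒S p)))
if?-disjoint-⊎ x (no _)  (yes q) S? _  _   Q⇒S _        = sym (if?-yes x S? (Q⇒S q))
if?-disjoint-⊎ x (no ¬p) (no ¬q) S? S⇒ _   _   _        = sym (if?-no x S? ([ ¬p , ¬q ] ∘ S⇒))

InWindow : ℕ → ℕ → ℕ → Set
InWindow a r v = a ≤ v × v < a + r

inWindow? : ∀ a r v → Dec (InWindow a r v)
inWindow? a r v = a ≤? v ×-dec v <? a + r

-- Both sides count x once exactly when suc v lies in the closed window [a, a + r].
window-suc : ∀ a r v x →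
  x if? inWindow? a r (suc v) + x if? (a + r ≟ suc v) ≡ x if? inWindow? a r v + x if? (a ≟ suc v)
window-suc a r v x =
  trans (if?-disjoint-⊎ x (inWindow? a r (suc v)) (a + r ≟ suc v) closed? S⇒L L⇒S end⇒S
           λ ((_ , v<) , e) → <⇒≢ v< (sym e))
        (sym (if?-disjoint-⊎ x (inWindow? a r v) (a ≟ suc v) closed? S⇒R R⇒S start⇒S
                λ ((a≤v , _) , e) → 1+n≰n (subst (_≤ v) e a≤v)))
  where
  closed? = a ≤? suc v ×-dec suc v ≤? a + r
  S⇒L : a ≤ suc v × suc v ≤ a + r → (a ≤ suc v × suc v < a + r) ⊎ a + r ≡ suc v
  S⇒L (a≤ , ≤a+r) = [ (λ < → inj₁ (a≤ , <)) , inj₂ ∘ sym ] (m≤n⇒m<n∨m≡n ≤a+r)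
  L⇒S : a ≤ suc v × suc v < a + r → a ≤ suc v × suc v ≤ a + r
  L⇒S (a≤ , <a+r) = a≤ , <⇒≤ <a+r
  end⇒S : a + r ≡ suc v → a ≤ suc v × suc v ≤ a + r
  end⇒S e = subst (a ≤_) e (m≤m+n a r) , ≤-reflexive (sym e)
  S⇒R : a ≤ suc v × suc v ≤ a + r → (a ≤ v × v < a + r) ⊎ a ≡ suc v
  S⇒R (a≤ , ≤a+r) = [ (λ a<sv → inj₁ (≤-pred a<sv , ≤a+r)) , inj₂ ] (m≤n⇒m<n∨m≡n a≤)
  R⇒S : a ≤ v × v < a + r → a ≤ suc v × suc v ≤ a + r
  R⇒S (a≤v , v<) = m≤n⇒m≤1+n a≤v , v<
  start⇒S : a ≡ suc v → a ≤ suc v × suc v ≤ a + r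
  start⇒S e = ≤-reflexive e , subst (_≤ a + r) e (m≤m+n a r)

stepwise-constant : ∀ (f : ℕ → ℕ) {a b} → (∀ v → a ≤ v → suc v ≤ b → f (suc v) ≡ f v) →
  ∀ {x} → a ≤ x → x ≤ b → f x ≡ f a
stepwise-constant f step {x = zero}  z≤n  _    = refl
stepwise-constant f step {x = suc x} a≤sx sx≤b with m≤n⇒m<n∨m≡n a≤sx
... | inj₁ a<sx = trans (step x (≤-pred a<sx) sx≤b)
                        (stepwise-constant f step (≤-pred a<sx) (≤-trans (n≤1+n x) sx≤b))
... | inj₂ refl = refl

module Intervals (r ℓ : ℕ) (start W : ℕ → ℕ) where

  covering startingAt endingAt : ℕ → ℕ → ℕ
  covering   v j = W j if? inWindow? (start j) r v
  startingAt v j = W j if? (start j ≟ v)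
  endingAt   v j = W j if? (start j + r ≟ v)

  load entering leaving : ℕ → ℕ
  load     v = sumBelow ℓ (covering v)
  entering v = sumBelow ℓ (startingAt v)
  leaving  v = sumBelow ℓ (endingAt v)

  load-suc : ∀ v → load (suc v) + leaving (suc v) ≡ load v + entering (suc v)
  load-suc v = begin
    load (suc v) + leaving (suc v)
      ≡⟨ sumBelow-+ ℓ (covering (suc v)) (endingAt (suc v)) ⟨
    sumBelow ℓ (λ j → covering (suc v) j + endingAt (suc v) j)
      ≡⟨ sumBelow-cong ℓ (λ j _ → window-suc (start j) r v (W j)) ⟩
    sumBelow ℓ (λ j → covering v j + startingAt (suc v) j)
      ≡⟨ sumBelow-+ ℓ (covering v) (startingAt (suc v)) ⟩
    load v + entering (suc v) ∎
    where open ≡-Reasoning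

  load-suc-≢ : ∀ v → entering (suc v) ≢ leaving (suc v) → load v ≢ load (suc v)
  load-suc-≢ v differ same = differ (sym (+-cancelˡ-≡ (load v) _ _
    (trans (cong (_+ leaving (suc v)) same) (load-suc v))))

  load-suc-≡ : ∀ v → entering (suc v) ≡ leaving (suc v) → load (suc v) ≡ load v
  load-suc-≡ v balanced = +-cancelʳ-≡ (leaving (suc v)) _ _
    (trans (load-suc v) (cong (load v +_) balanced))

σ≡load : ∀ r t ℓ (W : ℕ → ℕ) v → σ r t ℓ (W ∘ toℕ) v ≡ Intervals.load r ℓ (_* (r ∸ t)) W v
σ≡load r t ℓ W v = sumFin-toℕ ℓ (λ j → W j if? inWindow? (j * (r ∸ t)) r v)

σ-cong : ∀ r t ℓ {w w′ : Fin ℓ → ℕ} → (∀ i → w i ≡ w′ i) → ∀ v → σ r t ℓ w v ≡ σ r t ℓ w′ v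
σ-cong r t ℓ w≗w′ v = sumFin-cong ℓ (λ i → cong (λ y → if inEdge? r t ℓ v i then y else 0) (w≗w′ i))

1-weighting≡1 : ∀ {ℓ w} → IsWeighting ℓ 1 w → ∀ i → w i ≡ 1
1-weighting≡1 bounds i = ≤-antisym (proj₂ (bounds i)) (proj₁ (bounds i))

¬0-colourable : ∀ {r t ℓ} → 0 < ℓ → ¬ EdgeColourable r t ℓ 0
¬0-colourable {ℓ = suc _} _ (w , bounds , _) =
  1+n≰n (≤-trans (proj₁ (bounds F.zero)) (proj₂ (bounds F.zero)))

chiE≡1 : ∀ r t {ℓ} → 0 < ℓ → EdgeColourable r t ℓ 1 → ChiE≡ r t ℓ 1
chiE≡1 r t ℓ>0 colourable = colourable , λ { zero _ → ¬0-colourable {r} {t} ℓ>0 ; (suc _) (s≤s ()) }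

chiE≡2 : ∀ r t {ℓ} → 0 < ℓ → EdgeColourable r t ℓ 2 → ¬ EdgeColourable r t ℓ 1 → ChiE≡ r t ℓ 2
chiE≡2 r t ℓ>0 colourable ¬1-colourable = colourable , λ
  { zero          _              → ¬0-colourable {r} {t} ℓ>0
  ; (suc zero)    _              → ¬1-colourable
  ; (suc (suc _)) (s≤s (s≤s ())) }

module LoosePath (s ℓ : ℕ) (2≤s : 2 ≤ s) where

  open Intervals (suc s) ℓ (_* s) (λ _ → 1)

  ends-before : ∀ {j i} → j < i → j * s + suc s ≤ i * s + 1
  ends-before {j} {i} j<i = begin
    j * s + suc s   ≡⟨ +-suc (j * s) s ⟩
    suc (j * s + s) ≡⟨ cong suc (+-comm (j * s) s) ⟩
    suc (suc j * s) ≤⟨ s≤s (*-monoˡ-≤ s j<i) ⟩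
    suc (i * s)     ≡⟨ +-comm 1 (i * s) ⟩
    i * s + 1       ∎
    where open ≤-Reasoning

  starts-after : ∀ {i j} → i < j → i * s + 1 < j * s
  starts-after {i} {j} i<j = begin-strict
    i * s + 1 <⟨ +-monoʳ-< (i * s) 2≤s ⟩
    i * s + s ≡⟨ +-comm (i * s) s ⟩
    suc i * s ≤⟨ *-monoˡ-≤ s i<j ⟩
    j * s     ∎
    where open ≤-Reasoning

  inner∈edge : ∀ k → InWindow (k * s) (suc s) (k * s + 1)
  inner∈edge k = m≤m+n _ 1 , +-monoʳ-< (k * s) (s≤s (<⇒≤ 2≤s))

  last∈edge : ∀ k → InWindow (k * s) (suc s) (suc k * s)
  last∈edge k =
    m≤n+m _ s , subst (_< k * s + suc s) (+-comm (k * s) s) (+-monoʳ-< (k * s) (n<1+n s))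

  first∈edge : ∀ k → InWindow (k * s) (suc s) (k * s)
  first∈edge k = ≤-refl , m<m+n _ z<s

  load-inner : ∀ {k} → k < ℓ → load (k * s + 1) ≡ 1
  load-inner {k} k<ℓ =
    trans (sumBelow-single ℓ k<ℓ (λ j _ j≢k → if?-no 1 (inWindow? (j * s) (suc s) _)
                                                    (outside j j≢k)))
          (if?-yes 1 (inWindow? (k * s) (suc s) _) (inner∈edge k))
    where
    outside : ∀ j → j ≢ k → ¬ InWindow (j * s) (suc s) (k * s + 1)
    outside j j≢k (after , before) with <-cmp j k
    ... | tri< j<k _ _ = <⇒≱ before (ends-before j<k)
    ... | tri≈ _ j≡k _ = j≢k j≡k
    ... | tri> _ _ k<j = <⇒≱ (starts-after k<j) after

  load-shared : ∀ {k} → suc k < ℓ → 2 ≤ load (suc k * s)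
  load-shared {k} sk<ℓ =
    subst (_≤ load (suc k * s))
          (cong₂ _+_ (if?-yes 1 (inWindow? (k * s) (suc s) (suc k * s)) (last∈edge k))
                     (if?-yes 1 (inWindow? (suc k * s) (suc s) (suc k * s)) (first∈edge (suc k))))
          (twoTerms≤sumBelow ℓ (covering (suc k * s)) (n<1+n k) sk<ℓ)

  shared∈edge : 2 ≤ ℓ → ∀ k → k < ℓ → ∃[ v ] (InWindow (k * s) (suc s) v × 2 ≤ load v)
  shared∈edge 2≤ℓ zero    _    = 1 * s , last∈edge 0 , load-shared 2≤ℓ
  shared∈edge 2≤ℓ (suc k) sk<ℓ with suc (suc k) <? ℓ
  ... | yes ssk<ℓ = suc (suc k) * s , last∈edge (suc k) , load-shared ssk<ℓ
  ... | no _      = suc k * s , first∈edge (suc k) , load-shared sk<ℓ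

  1≢2 : ∀ {x y} → x ≡ 1 → 2 ≤ y → x ≢ y
  1≢2 refl (s≤s ()) refl

  loose-1-colourable : 2 ≤ ℓ → EdgeColourable (suc s) 1 ℓ 1
  loose-1-colourable 2≤ℓ = (λ _ → 1) , (λ _ → ≤-refl , ≤-refl) , proper
    where
    proper : ProperSigma (suc s) 1 ℓ (λ _ → 1)
    proper i with shared∈edge 2≤ℓ (toℕ i) (toℕ<n i)
    ... | v , v∈edge , 2≤load =
      toℕ i * s + 1 , v , inner∈edge (toℕ i) , v∈edge ,
      1≢2 (trans (σ≡load (suc s) 1 ℓ (λ _ → 1) _) (load-inner (toℕ<n i)))
          (subst (2 ≤_) (sym (σ≡load (suc s) 1 ℓ (λ _ → 1) v)) 2≤load)

module TightPath (s ℓ : ℕ) (W : ℕ → ℕ) where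

  open Intervals (suc s) ℓ id W public

  unit-step : ∀ j → j * (suc s ∸ s) ≡ j
  unit-step j = trans (cong (j *_) (m+n∸n≡m 1 s)) (*-identityʳ j)

  σ≡load-tight : ∀ v → σ (suc s) s ℓ (W ∘ toℕ) v ≡ load v
  σ≡load-tight v = trans (σ≡load (suc s) s ℓ W v)
    (sumBelow-cong ℓ (λ j _ → cong (λ a → W j if? inWindow? a (suc s) v) (unit-step j)))

  InEdge⇒InWindow : ∀ {u} i → InEdge (suc s) s ℓ u i → InWindow (toℕ i) (suc s) u
  InEdge⇒InWindow {u} i = subst (λ a → InWindow a (suc s) u) (unit-step (toℕ i))

  InWindow⇒InEdge : ∀ {u} i → InWindow (toℕ i) (suc s) u → InEdge (suc s) s ℓ u i
  InWindow⇒InEdge {u} i = subst (λ a → InWindow a (suc s) u) (sym (unit-step (toℕ i)))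

  entering-below : ∀ {v} → v < ℓ → entering v ≡ W v
  entering-below {v} v<ℓ =
    trans (sumBelow-single ℓ v<ℓ (λ j _ j≢v → if?-no (W j) (j ≟ v) j≢v))
          (if?-yes (W v) (v ≟ v) refl)

  entering-beyond : ∀ {v} → ℓ ≤ v → entering v ≡ 0
  entering-beyond {v} ℓ≤v =
    sumBelow-zero ℓ (λ j j<ℓ → if?-no (W j) (j ≟ v) (<⇒≢ (<-≤-trans j<ℓ ℓ≤v)))

  leaving-at : ∀ {j} → j < ℓ → leaving (j + suc s) ≡ W j
  leaving-at {j} j<ℓ =
    trans (sumBelow-single ℓ j<ℓ (λ k _ k≢j → if?-no (W k) (k + suc s ≟ j + suc s)
                                                    (k≢j ∘ +-cancelʳ-≡ (suc s) k j)))
          (if?-yes (W j) (j + suc s ≟ j + suc s) refl)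

  leaving-above : ∀ {v} → suc s ≤ v → v ∸ suc s < ℓ → leaving v ≡ W (v ∸ suc s)
  leaving-above r≤v j<ℓ = trans (cong leaving (sym (m∸n+n≡m r≤v))) (leaving-at j<ℓ)

  leaving-below : ∀ {v} → v < suc s → leaving v ≡ 0
  leaving-below {v} v<r =
    sumBelow-zero ℓ (λ j _ → if?-no (W j) (j + suc s ≟ v)
                               (λ e → <⇒≢ (<-≤-trans v<r (m≤n+m (suc s) j)) (sym e)))

  SeparatingStep : ℕ → Set
  SeparatingStep k = ∃[ v ] (k ≤ v × suc v < k + suc s × entering (suc v) ≢ leaving (suc v))

  suc∈edge : 1 ≤ s → ∀ k → suc k < k + suc s
  suc∈edge 1≤s k = subst (suc k <_) (sym (+-suc k s)) (s<s (m<m+n k 1≤s))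

  proper-by-steps : (∀ k → k < ℓ → SeparatingStep k) → ProperSigma (suc s) s ℓ (W ∘ toℕ)
  proper-by-steps steps i with steps (toℕ i) (toℕ<n i)
  ... | v , k≤v , sv<end , differ =
    v , suc v ,
    InWindow⇒InEdge i (k≤v , <-trans (n<1+n v) sv<end) ,
    InWindow⇒InEdge i (m≤n⇒m≤1+n k≤v , sv<end) ,
    λ same → load-suc-≢ v differ (trans (sym (σ≡load-tight v)) (trans same (σ≡load-tight (suc v))))

tight-¬1-colourable : ∀ s ℓ → s + s < ℓ → ¬ EdgeColourable (suc s) s ℓ 1
tight-¬1-colourable s ℓ 2s<ℓ (w , bounds , proper) =
  let u , v , u∈edge , v∈edge , differ = proper (fromℕ< s<ℓ)
  in differ (begin
    σ (suc s) s ℓ w u ≡⟨ σw≡load u ⟩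
    load u            ≡⟨ flat-edge u u∈edge ⟩
    load s            ≡⟨ flat-edge v v∈edge ⟨
    load v            ≡⟨ σw≡load v ⟨
    σ (suc s) s ℓ w v ∎)
  where
  open ≡-Reasoning
  open TightPath s ℓ (λ _ → 1)
  s<ℓ : s < ℓ
  s<ℓ = ≤-<-trans (m≤m+n s s) 2s<ℓ
  σw≡load : ∀ x → σ (suc s) s ℓ w x ≡ load x
  σw≡load x = trans (σ-cong (suc s) s ℓ (1-weighting≡1 bounds) x) (σ≡load-tight x)
  balanced : ∀ x → s ≤ x → suc x ≤ s + s → load (suc x) ≡ load x
  balanced x s≤x sx≤2s = load-suc-≡ x (trans (entering-below sx<ℓ)
    (sym (leaving-above (s≤s s≤x) (≤-<-trans (m∸n≤m x s) (<-trans (n<1+n x) sx<ℓ)))))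
    where
    sx<ℓ : suc x < ℓ
    sx<ℓ = ≤-<-trans sx≤2s 2s<ℓ
  flat-edge : ∀ x → InEdge (suc s) s ℓ x (fromℕ< s<ℓ) → load x ≡ load s
  flat-edge x x∈edge with InEdge⇒InWindow (fromℕ< s<ℓ) x∈edge
  ... | s≤x , x<end rewrite toℕ-fromℕ< s<ℓ =
    stepwise-constant load balanced s≤x (≤-pred (subst (suc x ≤_) (+-suc s s) x<end))

parityWeight : Parity → ℕ
parityWeight 0ℙ = 2
parityWeight 1ℙ = 1

parityWeight-injective : ∀ {p q} → parityWeight p ≡ parityWeight q → p ≡ q
parityWeight-injective {0ℙ} {0ℙ} _ = refl
parityWeight-injective {1ℙ} {1ℙ} _ = refl

parity-suc≢ : ∀ k → parity (suc k) ≢ parity k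
parity-suc≢ k e = p≢p⁻¹ (parity (suc k)) (trans e (sym (suc-homo-⁻¹ k)))

blockWeight : (r : ℕ) .{{_ : NonZero r}} → ℕ → ℕ
blockWeight r j = parityWeight (parity (j / r))

blockWeight-bounds : ∀ r .{{_ : NonZero r}} j → 1 ≤ blockWeight r j × blockWeight r j ≤ 2
blockWeight-bounds r j with parity (j / r)
... | 0ℙ = s≤s z≤n , ≤-refl
... | 1ℙ = ≤-refl , s≤s z≤n

blockWeight-shift : ∀ r .{{_ : NonZero r}} {j} → r ≤ j → blockWeight r j ≢ blockWeight r (j ∸ r)
blockWeight-shift r {j} r≤j same =
  parity-suc≢ ((j ∸ r) / r)
    (trans (sym (cong parity (m/n≡1+[m∸n]/n r≤j))) (parityWeight-injective same))

tight-2-colourable : ∀ s ℓ → 1 ≤ s → suc s ≤ ℓ → EdgeColourable (suc s) s ℓ 2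
tight-2-colourable s ℓ 1≤s r≤ℓ =
  blockWeight (suc s) ∘ toℕ , blockWeight-bounds (suc s) ∘ toℕ , proper-by-steps steps
  where
  open TightPath s ℓ (blockWeight (suc s))
  blockWeight≢0 : ∀ j → blockWeight (suc s) j ≢ 0
  blockWeight≢0 j = ≢-sym (<⇒≢ (proj₁ (blockWeight-bounds (suc s) j)))
  steps : ∀ k → k < ℓ → SeparatingStep k
  steps k k<ℓ = k , ≤-refl , suc∈edge 1≤s k , differ
    where
    j<ℓ : suc k ∸ suc s < ℓ
    j<ℓ = ≤-<-trans (m∸n≤m k s) k<ℓ
    differ : entering (suc k) ≢ leaving (suc k)
    differ with suc k <? ℓ | suc k <? suc s
    ... | yes sk<ℓ | yes sk<r = λ same →
      blockWeight≢0 (suc k) (trans (sym (entering-below sk<ℓ)) (trans same (leaving-below sk<r)))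
    ... | yes sk<ℓ | no sk≮r = λ same →
      blockWeight-shift (suc s) (≮⇒≥ sk≮r)
        (trans (sym (entering-below sk<ℓ)) (trans same (leaving-above (≮⇒≥ sk≮r) j<ℓ)))
    ... | no sk≮ℓ | _ = λ same →
      blockWeight≢0 (suc k ∸ suc s)
        (trans (sym (leaving-above (≤-trans r≤ℓ (≮⇒≥ sk≮ℓ)) j<ℓ))
               (trans (sym same) (entering-beyond (≮⇒≥ sk≮ℓ))))

tight-1-colourable : ∀ s ℓ → 1 ≤ s → 2 ≤ ℓ → ℓ ≤ s + s → EdgeColourable (suc s) s ℓ 1
tight-1-colourable s ℓ 1≤s 2≤ℓ ℓ≤2s = (λ _ → 1) , (λ _ → ≤-refl , ≤-refl) , proper-by-steps steps
  where
  open TightPath s ℓ (λ _ → 1)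
  first-step : ∀ k → suc k < ℓ → k < s → SeparatingStep k
  first-step k sk<ℓ k<s = k , ≤-refl , suc∈edge 1≤s k ,
    λ same → 1+n≢0 (trans (sym (entering-below sk<ℓ)) (trans same (leaving-below (s≤s k<s))))
  last-step : ∀ k → suc k < ℓ → ℓ ≤ suc k + s → SeparatingStep (suc k)
  last-step k sk<ℓ ℓ≤end = k + s , m<m+n k 1≤s , s<s (+-monoʳ-< k (n<1+n s)) ,
    λ same → 0≢1+n (trans (sym (entering-beyond ℓ≤end))
      (trans same (trans (cong leaving (sym (+-suc k s))) (leaving-at (<-trans (n<1+n k) sk<ℓ)))))
  steps : ∀ k → k < ℓ → SeparatingStep k
  steps zero    _   = first-step zero 2≤ℓ 1≤s
  steps (suc k) sk<ℓ with suc (suc k) <? ℓ | suc k <? s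
  ... | yes ssk<ℓ | yes sk<s = first-step (suc k) ssk<ℓ sk<s
  ... | no ssk≮ℓ  | _        = last-step k sk<ℓ (≤-trans (≮⇒≥ ssk≮ℓ) (s≤s (m<m+n k 1≤s)))
  ... | yes _     | no sk≮s  = last-step k sk<ℓ (≤-trans ℓ≤2s (+-monoˡ-≤ s (≮⇒≥ sk≮s)))

corollary3p4 : (r : ℕ) → 3 ≤ r → (ℓ : ℕ) → 2 < ℓ →
    ChiE≡ r 1 ℓ 1
    × (2 * r ∸ 1 ≤ ℓ → ChiE≡ r (r ∸ 1) ℓ 2)
    × (ℓ < 2 * r ∸ 1 → ChiE≡ r (r ∸ 1) ℓ 1)
corollary3p4 (suc s) (s≤s 2≤s) ℓ 2<ℓ =
    chiE≡1 (suc s) 1 ℓ>0 (LoosePath.loose-1-colourable s ℓ 2≤s 2≤ℓ)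
  , (λ long → let 2s<ℓ = subst (_≤ ℓ) 2r-1≡ long in
      chiE≡2 (suc s) s ℓ>0 (tight-2-colourable s ℓ 1≤s (≤-trans (s≤s (m≤n+m s s)) 2s<ℓ))
                           (tight-¬1-colourable s ℓ 2s<ℓ))
  , (λ short → chiE≡1 (suc s) s ℓ>0
      (tight-1-colourable s ℓ 1≤s 2≤ℓ (≤-pred (subst (suc ℓ ≤_) 2r-1≡ short))))
  where
  2≤ℓ : 2 ≤ ℓ
  2≤ℓ = <⇒≤ 2<ℓ
  ℓ>0 : 0 < ℓ
  ℓ>0 = ≤-trans (s≤s z≤n) 2≤ℓ
  1≤s : 1 ≤ s
  1≤s = ≤-trans (s≤s z≤n) 2≤s
  2r-1≡ : 2 * suc s ∸ 1 ≡ suc (s + s)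
  2r-1≡ = trans (cong (s +_) (+-identityʳ (suc s))) (+-suc s s)
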